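{- Let $(T,\eta,\mu)$ be a localisable monad on a symmetric monoidal category $\mathcal{C}$ with strength $\mathrm{st}$, and let $u\colon U\to I$ be a central idempotent. Then the following defines a monad $T|_u$ on $\mathcal{C}|_u$: $T|_u(A)=T(A)$; for a morphism $f\colon A\to B$ in $\mathcal{C}|_u$ (i.e. $f\colon A\otimes U\to B$ in $\mathcal{C}$), $T|_u(f)=T(f)\circ\mathrm{st}_{A,U}$; unit $(\eta|_u)_A=\eta_A\otimes u$; multiplication $(\mu|_u)_A=\mu_A\otimes u$ (up to unitors).
   Context: Let $\mathcal{C}$ be a symmetric monoidal category with unit $I$, unitors $\lambda,\rho$, associator $\alpha$ and symmetry $\sigma$ (coherence isomorphisms often suppressed). A central idempotent is a morphism $u\colon U\to I$ such that $\rho_U\circ(U\otimes u)=\lambda_U\circ(u\otimes U)\colon U\otimes U\to U$ and this morphism is invertible. For $u\leq v$ we mean $u=v\circ m$ for some $m\colon U\to V$. $\mathcal{C}|_u$ is the category with the objects of $\mathcal{C}$, morphisms $A\to B$ being morphisms $A\otimes U\to B$ of $\mathcal{C}$, composition of $f\colon A\otimes U\to B$ and $g\colon B\otimes U\to C$ given by $g\circ(f\otimes U)\circ(A\otimes U\otimes u)^{ -1}$, and identity $A\otimes u$. A monad $(T,\eta,\mu)$ on $\mathcal{C}$ is localisable when there are morphisms $\mathrm{st}_{A,U}\colon T(A)\otimes U\to T(A\otimes U)$ for each object $A$ and central idempotent $u\colon U\to I$ with: $T(\rho_A)\circ\mathrm{st}_{A,I}=\rho_{T(A)}$; $T(\alpha_{A,U,V})\circ\mathrm{st}_{A,U\otimes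 V}=\mathrm{st}_{A\otimes U,V}\circ(\mathrm{st}_{A,U}\otimes V)\circ\alpha_{TA,U,V}$; $\eta_{A\otimes U}=\mathrm{st}_{A,U}\circ(\eta_A\otimes U)$; $\mu_{A\otimes U}\circ T(\mathrm{st}_{A,U})\circ\mathrm{st}_{T(A),U}=\mathrm{st}_{A,U}\circ(\mu_A\otimes U)$; $\mathrm{st}_{A,V}\circ(T(A)\otimes m)=T(A\otimes m)\circ\mathrm{st}_{A,U}$ whenever $u=v\circ m$; and $\mathrm{st}_{B,U}\circ(T(f)\otimes U)=T(f\otimes U)\circ\mathrm{st}_{A,U}$ for all $f\colon A\to B$. -}

module Defs where

open import Level using (Level; _⊔_; suc)
open import Relation.Binary.Structures using (IsEquivalence)

record RawCategory (o ℓ e : Level) : Set (suc (o ⊔ ℓ ⊔ e)) where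
  infixr 9 _∘_
  infix  4 _≈_ _⇒_
  field
    Obj : Set o
    _⇒_ : Obj → Obj → Set ℓ
    _≈_ : ∀ {A B} → A ⇒ B → A ⇒ B → Set e
    id  : ∀ {A} → A ⇒ A
    _∘_ : ∀ {A B C} → B ⇒ C → A ⇒ B → A ⇒ C

record Category (o ℓ e : Level) : Set (suc (o ⊔ ℓ ⊔ e)) where
  field
    raw : RawCategory o ℓ e
  open RawCategory raw public
  field
    equiv     : ∀ {A B} → IsEquivalence (_≈_ {A} {B})
    ∘-resp-≈  : ∀ {A B C} {f h : B ⇒ C} {g i : A ⇒ B} →
                f ≈ h → g ≈ i → f ∘ g ≈ h ∘ i
    assoc     : ∀ {A B C D} {f : A ⇒ B} {g : B ⇒ C} {h : C ⇒ D} →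
                (h ∘ g) ∘ f ≈ h ∘ (g ∘ f)
    identityˡ : ∀ {A B} {f : A ⇒ B} → id ∘ f ≈ f
    identityʳ : ∀ {A B} {f : A ⇒ B} → f ∘ id ≈ f

record MonadData {o ℓ e} (D : RawCategory o ℓ e) : Set (o ⊔ ℓ) where
  open RawCategory D
  field
    F₀ : Obj → Obj
    F₁ : ∀ {A B} → A ⇒ B → F₀ A ⇒ F₀ B
    η  : ∀ A → A ⇒ F₀ A
    μ  : ∀ A → F₀ (F₀ A) ⇒ F₀ A

record IsMonad {o ℓ e} (D : RawCategory o ℓ e) (M : MonadData D)
       : Set (o ⊔ ℓ ⊔ e) where
  open RawCategory D
  open MonadData M
  field
    F-resp-≈     : ∀ {A B} {f g : A ⇒ B} → f ≈ g → F₁ f ≈ F₁ g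
    F-identity   : ∀ {A} → F₁ (id {A}) ≈ id
    F-homomorphism : ∀ {A B C} {f : A ⇒ B} {g : B ⇒ C} →
                   F₁ (g ∘ f) ≈ F₁ g ∘ F₁ f
    η-natural    : ∀ {A B} (f : A ⇒ B) → η B ∘ f ≈ F₁ f ∘ η A
    μ-natural    : ∀ {A B} (f : A ⇒ B) → μ B ∘ F₁ (F₁ f) ≈ F₁ f ∘ μ A
    assoc        : ∀ {A} → μ A ∘ F₁ (μ A) ≈ μ A ∘ μ (F₀ A)
    identityˡ    : ∀ {A} → μ A ∘ F₁ (η A) ≈ id
    identityʳ    : ∀ {A} → μ A ∘ η (F₀ A) ≈ id

record Monad {o ℓ e} (D : RawCategory o ℓ e) : Set (o ⊔ ℓ ⊔ e) where
  field
    monadData : MonadData D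
    isMonad   : IsMonad D monadData
  open MonadData monadData public
  open IsMonad isMonad public

record SymmetricMonoidal {o ℓ e} (C : Category o ℓ e) : Set (o ⊔ ℓ ⊔ e) where
  open Category C
  infixr 10 _⊗₀_ _⊗₁_
  field
    _⊗₀_ : Obj → Obj → Obj
    _⊗₁_ : ∀ {A B X Y} → A ⇒ B → X ⇒ Y → (A ⊗₀ X) ⇒ (B ⊗₀ Y)
    I    : Obj
    ⊗-identity : ∀ {A B} → id {A} ⊗₁ id {B} ≈ id
    ⊗-homomorphism : ∀ {A B C X Y Z} {f : A ⇒ B} {g : B ⇒ C}
                       {h : X ⇒ Y} {k : Y ⇒ Z} →
                     (g ∘ f) ⊗₁ (k ∘ h) ≈ (g ⊗₁ k) ∘ (f ⊗₁ h)
    ⊗-resp-≈ : ∀ {A B X Y} {f g : A ⇒ B} {h k : X ⇒ Y} →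
               f ≈ g → h ≈ k → f ⊗₁ h ≈ g ⊗₁ k

    λ⇒ : ∀ {A} → I ⊗₀ A ⇒ A
    λ⇐ : ∀ {A} → A ⇒ I ⊗₀ A
    λ-isoˡ : ∀ {A} → λ⇐ ∘ λ⇒ ≈ id {I ⊗₀ A}
    λ-isoʳ : ∀ {A} → λ⇒ ∘ λ⇐ ≈ id {A}
    λ-natural : ∀ {A B} {f : A ⇒ B} → f ∘ λ⇒ ≈ λ⇒ ∘ (id ⊗₁ f)

    ρ⇒ : ∀ {A} → A ⊗₀ I ⇒ A
    ρ⇐ : ∀ {A} → A ⇒ A ⊗₀ I
    ρ-isoˡ : ∀ {A} → ρ⇐ ∘ ρ⇒ ≈ id {A ⊗₀ I}
    ρ-isoʳ : ∀ {A} → ρ⇒ ∘ ρ⇐ ≈ id {A}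
    ρ-natural : ∀ {A B} {f : A ⇒ B} → f ∘ ρ⇒ ≈ ρ⇒ ∘ (f ⊗₁ id)

    α⇒ : ∀ {A B C} → (A ⊗₀ B) ⊗₀ C ⇒ A ⊗₀ (B ⊗₀ C)
    α⇐ : ∀ {A B C} → A ⊗₀ (B ⊗₀ C) ⇒ (A ⊗₀ B) ⊗₀ C
    α-isoˡ : ∀ {A B C} → α⇐ ∘ α⇒ ≈ id {(A ⊗₀ B) ⊗₀ C}
    α-isoʳ : ∀ {A B C} → α⇒ ∘ α⇐ ≈ id {A ⊗₀ (B ⊗₀ C)}
    α-natural : ∀ {A B C X Y Z} {f : A ⇒ X} {g : B ⇒ Y} {h : C ⇒ Z} →
                (f ⊗₁ (g ⊗₁ h)) ∘ α⇒ ≈ α⇒ ∘ ((f ⊗₁ g) ⊗₁ h)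

    triangle : ∀ {A B} → (id {A} ⊗₁ λ⇒ {B}) ∘ α⇒ ≈ ρ⇒ ⊗₁ id
    pentagon : ∀ {A B C D} →
               (id {A} ⊗₁ α⇒ {B} {C} {D}) ∘ α⇒ ∘ (α⇒ ⊗₁ id) ≈ α⇒ ∘ α⇒

    σ : ∀ {A B} → A ⊗₀ B ⇒ B ⊗₀ A
    σ-involutive : ∀ {A B} → σ ∘ σ ≈ id {A ⊗₀ B}
    σ-natural : ∀ {A B X Y} {f : A ⇒ X} {g : B ⇒ Y} →
                (g ⊗₁ f) ∘ σ ≈ σ ∘ (f ⊗₁ g)
    hexagon : ∀ {A B C} →
              α⇒ {B} {C} {A} ∘ σ ∘ α⇒ ≈ (id ⊗₁ σ) ∘ α⇒ ∘ (σ ⊗₁ id {C})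

module _ {o ℓ e} {C : Category o ℓ e} (M : SymmetricMonoidal C) where
  open Category C
  open SymmetricMonoidal M

  record IsCentralIdempotent {U : Obj} (u : U ⇒ I) : Set (ℓ ⊔ e) where
    field
      central : ρ⇒ ∘ (id ⊗₁ u) ≈ λ⇒ ∘ (u ⊗₁ id)
      inv     : U ⇒ U ⊗₀ U
      isoˡ    : inv ∘ (ρ⇒ ∘ (id ⊗₁ u)) ≈ id
      isoʳ    : (ρ⇒ ∘ (id ⊗₁ u)) ∘ inv ≈ id

  -- Localisable monad: a monad T on C together with st_{A,u} for every
  -- object A and central idempotent u (st may a priori depend on the
  -- witness of centrality; the order axiom with m = id forces it not to).
  record Localisable (T : Monad raw) : Set (o ⊔ ℓ ⊔ e) where
    open Monad T renaming (F₀ to T₀; F₁ to T₁)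
    field
      st : ∀ A {U} (u : U ⇒ I) → IsCentralIdempotent u →
           T₀ A ⊗₀ U ⇒ T₀ (A ⊗₀ U)
      st-unitor : ∀ {A} (p : IsCentralIdempotent (id {I})) →
                  T₁ (ρ⇒ {A}) ∘ st A id p ≈ ρ⇒
      -- u ⊗ v : U ⊗ V → I is λ_I ∘ (u ⊗₁ v); the paper's α_{X,U,V} is
      -- X ⊗ (U ⊗ V) → (X ⊗ U) ⊗ V, i.e. α⇐ here.
      st-assoc : ∀ {A U V} {u : U ⇒ I} {v : V ⇒ I}
                 (pu : IsCentralIdempotent u) (pv : IsCentralIdempotent v)
                 (puv : IsCentralIdempotent (λ⇒ ∘ (u ⊗₁ v))) →
                 T₁ (α⇐ {A} {U} {V}) ∘ st A (λ⇒ ∘ (u ⊗₁ v)) puv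
                 ≈ st (A ⊗₀ U) v pv ∘ (st A u pu ⊗₁ id) ∘ α⇐
      st-η : ∀ {A U} {u : U ⇒ I} (pu : IsCentralIdempotent u) →
             η (A ⊗₀ U) ≈ st A u pu ∘ (η A ⊗₁ id)
      st-μ : ∀ {A U} {u : U ⇒ I} (pu : IsCentralIdempotent u) →
             μ (A ⊗₀ U) ∘ T₁ (st A u pu) ∘ st (T₀ A) u pu
             ≈ st A u pu ∘ (μ A ⊗₁ id)
      st-≤ : ∀ {A U V} {u : U ⇒ I} {v : V ⇒ I}
             (pu : IsCentralIdempotent u) (pv : IsCentralIdempotent v)
             (m : U ⇒ V) → u ≈ v ∘ m →
             st A v pv ∘ (id ⊗₁ m) ≈ T₁ (id ⊗₁ m) ∘ st A u pu
      st-natural : ∀ {A B U} {u : U ⇒ I} (pu : IsCentralIdempotent u)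
                   (f : A ⇒ B) →
                   st B u pu ∘ (T₁ f ⊗₁ id) ≈ T₁ (f ⊗₁ id) ∘ st A u pu

  -- Composition of f : A ⊗ U → B and
  -- g : B ⊗ U → C is g ∘ (f ⊗ U) ∘ (A ⊗ U ⊗ u)⁻¹, where the morphism
  -- A ⊗ U ⊗ u = ρ ∘ ((A ⊗ U) ⊗ u) : (A ⊗ U) ⊗ U → A ⊗ U has inverse
  -- α⁻¹ ∘ (A ⊗ inv).
  restrict : ∀ {U} (u : U ⇒ I) → IsCentralIdempotent u → RawCategory o ℓ e
  restrict {U} u pu = record
    { Obj = Obj
    ; _⇒_ = λ A B → (A ⊗₀ U) ⇒ B
    ; _≈_ = _≈_
    ; id  = ρ⇒ ∘ (id ⊗₁ u)
    ; _∘_ = λ g f → g ∘ (f ⊗₁ id) ∘ α⇐ ∘ (id ⊗₁ IsCentralIdempotent.inv pu)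
    }

  restrictMonad : (T : Monad raw) → Localisable T →
                  ∀ {U} (u : U ⇒ I) (pu : IsCentralIdempotent u) →
                  MonadData (restrict u pu)
  restrictMonad T L u pu = record
    { F₀ = T₀
    ; F₁ = λ {A} f → T₁ f ∘ Localisable.st L A u pu
    ; η  = λ A → ρ⇒ ∘ (η A ⊗₁ u)
    ; μ  = λ A → ρ⇒ ∘ (μ A ⊗₁ u)
    }
    where open Monad T renaming (F₀ to T₀; F₁ to T₁)

{-# OPTIONS --safe #-}
module Submission where

-- Write ε = A ⊗ u : A ⊗ U → A for the identity of C|_u and δ = α⁻¹ ∘ (A ⊗ inv) for the
-- diagonal A ⊗ U → (A ⊗ U) ⊗ U occurring in its composition, inv being the inverse of
-- U ⊗ u; then ε ∘ δ = id, and (ε ⊗ U) ∘ δ = id by centrality.  Hence a composite in C|_u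
-- with a morphism of the form h ∘ ε on either side collapses to a composite in C.  Unit
-- and multiplication of T|_u have this form, and T|_u (h ∘ ε) = T h ∘ ε because st along
-- u ≤ id is the unitor, so the monad laws reduce to those of T and naturality to the
-- unit and multiplication axioms of st.  Functoriality uses st along u ⊗ u, a central
-- idempotent since it is u transported along U ⊗ u : U ⊗ U ≅ U, restricted along
-- u ≤ u ⊗ u.

open import Defs
open import Relation.Binary.Bundles using (Setoid)
open import Relation.Binary.Structures using (IsEquivalence)
import Relation.Binary.Reasoning.Setoid as SetoidReasoning

module HomReasoning {o ℓ e} (C : Category o ℓ e) where
  open Category C

  module _ {A B : Obj} where
    open IsEquivalence (equiv {A} {B}) public
      using () renaming (refl to ≈-refl; sym to ≈-sym; trans to ≈-trans)

  hom-setoid : Obj → Obj → Setoid ℓ e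
  hom-setoid A B = record { Carrier = A ⇒ B ; _≈_ = _≈_ ; isEquivalence = equiv }

  module _ {A B : Obj} where
    open SetoidReasoning (hom-setoid A B) public

  infixr 4 refl⟩∘⟨_
  infixl 5 _⟩∘⟨refl

  refl⟩∘⟨_ : ∀ {A B D} {f : B ⇒ D} {g h : A ⇒ B} → g ≈ h → f ∘ g ≈ f ∘ h
  refl⟩∘⟨ p = ∘-resp-≈ ≈-refl p

  _⟩∘⟨refl : ∀ {A B D} {f g : B ⇒ D} {h : A ⇒ B} → f ≈ g → f ∘ h ≈ g ∘ h
  p ⟩∘⟨refl = ∘-resp-≈ p ≈-refl

  sym-assoc : ∀ {A B D E} {f : A ⇒ B} {g : B ⇒ D} {h : D ⇒ E} →
              h ∘ (g ∘ f) ≈ (h ∘ g) ∘ f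
  sym-assoc = ≈-sym assoc

  module _ {A B D E : Obj} {a : D ⇒ E} {b : B ⇒ D} {c : B ⇒ E} (ab≈c : a ∘ b ≈ c) where
    pullˡ : ∀ {f : A ⇒ B} → a ∘ (b ∘ f) ≈ c ∘ f
    pullˡ = ≈-trans sym-assoc (ab≈c ⟩∘⟨refl)

  module _ {A B D E : Obj} {a : A ⇒ B} {b : B ⇒ D} {c : A ⇒ D} (ba≈c : b ∘ a ≈ c) where
    pullʳ : ∀ {f : D ⇒ E} → (f ∘ b) ∘ a ≈ f ∘ c
    pullʳ = ≈-trans assoc (refl⟩∘⟨ ba≈c)

  elimʳ : ∀ {A B} {f : A ⇒ A} {g : A ⇒ B} → f ≈ id → g ∘ f ≈ g
  elimʳ f≈id = ≈-trans (refl⟩∘⟨ f≈id) identityʳ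

  cancelˡ : ∀ {A B D} {a : B ⇒ D} {b : D ⇒ B} {f : A ⇒ B} → b ∘ a ≈ id → b ∘ (a ∘ f) ≈ f
  cancelˡ ba≈id = ≈-trans (pullˡ ba≈id) identityˡ

  cancelʳ : ∀ {A B D} {a : A ⇒ B} {b : B ⇒ A} {f : A ⇒ D} → b ∘ a ≈ id → (f ∘ b) ∘ a ≈ f
  cancelʳ ba≈id = ≈-trans (pullʳ ba≈id) identityʳ

  cancel-middle : ∀ {A B D E} {a : A ⇒ B} {b : B ⇒ A} {f : A ⇒ E} {g : D ⇒ A} →
                  b ∘ a ≈ id → (f ∘ b) ∘ (a ∘ g) ≈ f ∘ g
  cancel-middle ba≈id = ≈-trans assoc (refl⟩∘⟨ cancelˡ ba≈id)

  split-mono : ∀ {A B D} {φ : B ⇒ D} {ψ : D ⇒ B} {f g : A ⇒ B} →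
               ψ ∘ φ ≈ id → φ ∘ f ≈ φ ∘ g → f ≈ g
  split-mono {φ = φ} {ψ} {f} {g} ψφ≈id φf≈φg = begin
    f            ≈⟨ cancelˡ ψφ≈id ⟨
    ψ ∘ (φ ∘ f)  ≈⟨ refl⟩∘⟨ φf≈φg ⟩
    ψ ∘ (φ ∘ g)  ≈⟨ cancelˡ ψφ≈id ⟩
    g            ∎

  split-epi : ∀ {A B D} {φ : A ⇒ B} {ψ : B ⇒ A} {f g : B ⇒ D} →
              φ ∘ ψ ≈ id → f ∘ φ ≈ g ∘ φ → f ≈ g
  split-epi {φ = φ} {ψ} {f} {g} φψ≈id fφ≈gφ = begin
    f            ≈⟨ cancelʳ φψ≈id ⟨
    (f ∘ φ) ∘ ψ  ≈⟨ fφ≈gφ ⟩∘⟨refl ⟩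
    (g ∘ φ) ∘ ψ  ≈⟨ cancelʳ φψ≈id ⟩
    g            ∎

module MonoidalReasoning {o ℓ e} {C : Category o ℓ e} (M : SymmetricMonoidal C) where
  open Category C
  open SymmetricMonoidal M
  open HomReasoning C public

  ⊗-merge : ∀ {A B D X Y Z} {f : A ⇒ B} {g : B ⇒ D} {h : X ⇒ Y} {k : Y ⇒ Z} →
            (g ⊗₁ k) ∘ (f ⊗₁ h) ≈ (g ∘ f) ⊗₁ (k ∘ h)
  ⊗-merge = ≈-sym ⊗-homomorphism

  id⊗-merge : ∀ {A X Y Z} {h : X ⇒ Y} {k : Y ⇒ Z} →
              (id {A} ⊗₁ k) ∘ (id ⊗₁ h) ≈ id ⊗₁ (k ∘ h)
  id⊗-merge = ≈-trans ⊗-merge (⊗-resp-≈ identityˡ ≈-refl)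

  ⊗id-merge : ∀ {A B D X} {f : A ⇒ B} {g : B ⇒ D} →
              (g ⊗₁ id {X}) ∘ (f ⊗₁ id) ≈ (g ∘ f) ⊗₁ id
  ⊗id-merge = ≈-trans ⊗-merge (⊗-resp-≈ ≈-refl identityˡ)

  ⊗-split : ∀ {A B X Y} {f : A ⇒ B} {g : X ⇒ Y} → f ⊗₁ g ≈ (f ⊗₁ id) ∘ (id ⊗₁ g)
  ⊗-split = ≈-trans (⊗-resp-≈ (≈-sym identityʳ) (≈-sym identityˡ)) ⊗-homomorphism

  ⊗-resp-id : ∀ {A X} {f : A ⇒ A} {g : X ⇒ X} → f ≈ id → g ≈ id → f ⊗₁ g ≈ id
  ⊗-resp-id f≈id g≈id = ≈-trans (⊗-resp-≈ f≈id g≈id) ⊗-identity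

  ⊗id-injective : ∀ {A B} {f g : A ⇒ B} → f ⊗₁ id {I} ≈ g ⊗₁ id → f ≈ g
  ⊗id-injective {f = f} {g} f⊗id≈g⊗id = split-epi ρ-isoʳ (begin
    f ∘ ρ⇒          ≈⟨ ρ-natural ⟩
    ρ⇒ ∘ (f ⊗₁ id)  ≈⟨ refl⟩∘⟨ f⊗id≈g⊗id ⟩
    ρ⇒ ∘ (g ⊗₁ id)  ≈⟨ ρ-natural ⟨
    g ∘ ρ⇒          ∎)

  id⊗-injective : ∀ {A B} {f g : A ⇒ B} → id {I} ⊗₁ f ≈ id ⊗₁ g → f ≈ g
  id⊗-injective {f = f} {g} id⊗f≈id⊗g = split-epi λ-isoʳ (begin
    f ∘ λ⇒          ≈⟨ λ-natural ⟩
    λ⇒ ∘ (id ⊗₁ f)  ≈⟨ refl⟩∘⟨ id⊗f≈id⊗g ⟩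
    λ⇒ ∘ (id ⊗₁ g)  ≈⟨ λ-natural ⟨
    g ∘ λ⇒          ∎)

  α⇐-natural : ∀ {A B D X Y Z} {f : A ⇒ X} {g : B ⇒ Y} {h : D ⇒ Z} →
               ((f ⊗₁ g) ⊗₁ h) ∘ α⇐ ≈ α⇐ ∘ (f ⊗₁ (g ⊗₁ h))
  α⇐-natural {f = f} {g} {h} = split-mono α-isoˡ (begin
    α⇒ ∘ (((f ⊗₁ g) ⊗₁ h) ∘ α⇐)  ≈⟨ pullˡ (≈-sym α-natural) ⟩
    ((f ⊗₁ (g ⊗₁ h)) ∘ α⇒) ∘ α⇐  ≈⟨ cancelʳ α-isoʳ ⟩
    f ⊗₁ (g ⊗₁ h)                ≈⟨ cancelˡ α-isoʳ ⟨
    α⇒ ∘ (α⇐ ∘ (f ⊗₁ (g ⊗₁ h)))  ∎)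

  -- Kelly's lemma: after tensoring with id {I} it follows from the pentagon and triangle.
  ρ⇒-⊗₀ : ∀ {A B} → ρ⇒ {A ⊗₀ B} ≈ (id ⊗₁ ρ⇒) ∘ α⇒
  ρ⇒-⊗₀ = ⊗id-injective (split-mono α-isoˡ (begin
    α⇒ ∘ (ρ⇒ ⊗₁ id)                                      ≈⟨ refl⟩∘⟨ triangle ⟨
    α⇒ ∘ ((id ⊗₁ λ⇒) ∘ α⇒)                               ≈⟨ refl⟩∘⟨ (⊗-resp-≈ ⊗-identity ≈-refl ⟩∘⟨refl) ⟨
    α⇒ ∘ (((id ⊗₁ id) ⊗₁ λ⇒) ∘ α⇒)                       ≈⟨ pullˡ (≈-sym α-natural) ⟩
    ((id ⊗₁ (id ⊗₁ λ⇒)) ∘ α⇒) ∘ α⇒                       ≈⟨ assoc ⟩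
    (id ⊗₁ (id ⊗₁ λ⇒)) ∘ (α⇒ ∘ α⇒)                       ≈⟨ refl⟩∘⟨ pentagon ⟨
    (id ⊗₁ (id ⊗₁ λ⇒)) ∘ ((id ⊗₁ α⇒) ∘ α⇒ ∘ (α⇒ ⊗₁ id))  ≈⟨ pullˡ id⊗-merge ⟩
    (id ⊗₁ ((id ⊗₁ λ⇒) ∘ α⇒)) ∘ (α⇒ ∘ (α⇒ ⊗₁ id))        ≈⟨ ⊗-resp-≈ ≈-refl triangle ⟩∘⟨refl ⟩
    (id ⊗₁ (ρ⇒ ⊗₁ id)) ∘ (α⇒ ∘ (α⇒ ⊗₁ id))               ≈⟨ pullˡ α-natural ⟩
    (α⇒ ∘ ((id ⊗₁ ρ⇒) ⊗₁ id)) ∘ (α⇒ ⊗₁ id)               ≈⟨ pullʳ ⊗id-merge ⟩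
    α⇒ ∘ (((id ⊗₁ ρ⇒) ∘ α⇒) ⊗₁ id)                       ∎))

  λ⇒≈ρ⇒ : λ⇒ {I} ≈ ρ⇒ {I}
  λ⇒≈ρ⇒ = id⊗-injective (split-epi α-isoʳ (begin
    (id ⊗₁ λ⇒) ∘ α⇒  ≈⟨ triangle ⟩
    ρ⇒ ⊗₁ id         ≈⟨ split-mono ρ-isoˡ ρ-natural ⟨
    ρ⇒               ≈⟨ ρ⇒-⊗₀ ⟩
    (id ⊗₁ ρ⇒) ∘ α⇒  ∎))

  ρ⇒∘α⇐ : ∀ {A B} → ρ⇒ ∘ α⇐ ≈ id {A} ⊗₁ ρ⇒ {B}
  ρ⇒∘α⇐ = ≈-trans (ρ⇒-⊗₀ ⟩∘⟨refl) (cancelʳ α-isoʳ)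

  ρ⇒⊗id∘α⇐ : ∀ {A B} → (ρ⇒ ⊗₁ id) ∘ α⇐ ≈ id {A} ⊗₁ λ⇒ {B}
  ρ⇒⊗id∘α⇐ = ≈-trans (≈-sym triangle ⟩∘⟨refl) (cancelʳ α-isoʳ)

module CentralIdempotents {o ℓ e} {C : Category o ℓ e} (M : SymmetricMonoidal C) where
  open Category C
  open SymmetricMonoidal M
  open MonoidalReasoning M

  id-isCentralIdempotent : IsCentralIdempotent M (id {I})
  id-isCentralIdempotent = record
    { central = ≈-trans (elimʳ ⊗-identity) (≈-trans (≈-sym λ⇒≈ρ⇒) (≈-sym (elimʳ ⊗-identity)))
    ; inv     = ρ⇐
    ; isoˡ    = ≈-trans (refl⟩∘⟨ elimʳ ⊗-identity) ρ-isoˡ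
    ; isoʳ    = ≈-trans (elimʳ ⊗-identity ⟩∘⟨refl) ρ-isoʳ
    }

  IsCentralIdempotent-resp-≈ : ∀ {U} {u v : U ⇒ I} → u ≈ v →
                               IsCentralIdempotent M u → IsCentralIdempotent M v
  IsCentralIdempotent-resp-≈ {u = u} {v} u≈v pu = record
    { central = ≈-trans (refl⟩∘⟨ ⊗-resp-≈ ≈-refl v≈u) (≈-trans central (refl⟩∘⟨ ⊗-resp-≈ u≈v ≈-refl))
    ; inv     = inv
    ; isoˡ    = ≈-trans (refl⟩∘⟨ refl⟩∘⟨ ⊗-resp-≈ ≈-refl v≈u) isoˡ
    ; isoʳ    = ≈-trans ((refl⟩∘⟨ ⊗-resp-≈ ≈-refl v≈u) ⟩∘⟨refl) isoʳ
    }
    where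
    open IsCentralIdempotent pu
    v≈u : v ≈ u
    v≈u = ≈-sym u≈v

  -- Both structure maps of u ∘ φ are those of u conjugated by φ.
  IsCentralIdempotent-∘-iso : ∀ {U V} {u : U ⇒ I} (φ : V ⇒ U) (ψ : U ⇒ V) →
                              ψ ∘ φ ≈ id → φ ∘ ψ ≈ id →
                              IsCentralIdempotent M u → IsCentralIdempotent M (u ∘ φ)
  IsCentralIdempotent-∘-iso {U} {u = u} φ ψ ψφ≈id φψ≈id pu = record
    { central = begin
        ρ⇒ ∘ (id ⊗₁ (u ∘ φ))               ≈⟨ ρ⇒-conjugate ⟩
        ψ ∘ ((ρ⇒ ∘ (id ⊗₁ u)) ∘ (φ ⊗₁ φ))  ≈⟨ refl⟩∘⟨ central ⟩∘⟨refl ⟩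
        ψ ∘ ((λ⇒ ∘ (u ⊗₁ id)) ∘ (φ ⊗₁ φ))  ≈⟨ λ⇒-conjugate ⟨
        λ⇒ ∘ ((u ∘ φ) ⊗₁ id)               ∎
    ; inv     = ((ψ ⊗₁ ψ) ∘ inv) ∘ φ
    ; isoˡ    = begin
        (((ψ ⊗₁ ψ) ∘ inv) ∘ φ) ∘ (ρ⇒ ∘ (id ⊗₁ (u ∘ φ)))  ≈⟨ refl⟩∘⟨ ρ⇒-conjugate ⟩
        (((ψ ⊗₁ ψ) ∘ inv) ∘ φ) ∘ (ψ ∘ (ε ∘ (φ ⊗₁ φ)))    ≈⟨ cancel-middle φψ≈id ⟩
        ((ψ ⊗₁ ψ) ∘ inv) ∘ (ε ∘ (φ ⊗₁ φ))                ≈⟨ cancel-middle isoˡ ⟩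
        (ψ ⊗₁ ψ) ∘ (φ ⊗₁ φ)                              ≈⟨ ψ⊗ψ∘φ⊗φ≈id ⟩
        id                                               ∎
    ; isoʳ    = begin
        (ρ⇒ ∘ (id ⊗₁ (u ∘ φ))) ∘ (((ψ ⊗₁ ψ) ∘ inv) ∘ φ)  ≈⟨ ρ⇒-conjugate ⟩∘⟨refl ⟩
        (ψ ∘ (ε ∘ (φ ⊗₁ φ))) ∘ (((ψ ⊗₁ ψ) ∘ inv) ∘ φ)    ≈⟨ assoc ⟩
        ψ ∘ ((ε ∘ (φ ⊗₁ φ)) ∘ (((ψ ⊗₁ ψ) ∘ inv) ∘ φ))    ≈⟨ refl⟩∘⟨ refl⟩∘⟨ assoc ⟩
        ψ ∘ ((ε ∘ (φ ⊗₁ φ)) ∘ ((ψ ⊗₁ ψ) ∘ (inv ∘ φ)))    ≈⟨ refl⟩∘⟨ cancel-middle φ⊗φ∘ψ⊗ψ≈id ⟩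
        ψ ∘ (ε ∘ (inv ∘ φ))                              ≈⟨ refl⟩∘⟨ cancelˡ isoʳ ⟩
        ψ ∘ φ                                            ≈⟨ ψφ≈id ⟩
        id                                               ∎
    }
    where
    open IsCentralIdempotent pu
    ε : U ⊗₀ U ⇒ U
    ε = ρ⇒ ∘ (id ⊗₁ u)

    ψ⊗ψ∘φ⊗φ≈id : (ψ ⊗₁ ψ) ∘ (φ ⊗₁ φ) ≈ id
    ψ⊗ψ∘φ⊗φ≈id = ≈-trans ⊗-merge (⊗-resp-id ψφ≈id ψφ≈id)

    φ⊗φ∘ψ⊗ψ≈id : (φ ⊗₁ φ) ∘ (ψ ⊗₁ ψ) ≈ id
    φ⊗φ∘ψ⊗ψ≈id = ≈-trans ⊗-merge (⊗-resp-id φψ≈id φψ≈id)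

    ρ⇒-conjugate : ρ⇒ ∘ (id ⊗₁ (u ∘ φ)) ≈ ψ ∘ (ε ∘ (φ ⊗₁ φ))
    ρ⇒-conjugate = begin
      ρ⇒ ∘ (id ⊗₁ (u ∘ φ))                      ≈⟨ cancelˡ ψφ≈id ⟨
      ψ ∘ (φ ∘ (ρ⇒ ∘ (id ⊗₁ (u ∘ φ))))          ≈⟨ refl⟩∘⟨ pullˡ ρ-natural ⟩
      ψ ∘ ((ρ⇒ ∘ (φ ⊗₁ id)) ∘ (id ⊗₁ (u ∘ φ)))  ≈⟨ refl⟩∘⟨ pullʳ ⊗-merge ⟩
      ψ ∘ (ρ⇒ ∘ ((φ ∘ id) ⊗₁ (id ∘ u ∘ φ)))     ≈⟨ refl⟩∘⟨ refl⟩∘⟨ ⊗-resp-≈ (≈-trans identityʳ (≈-sym identityˡ)) identityˡ ⟩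
      ψ ∘ (ρ⇒ ∘ ((id ∘ φ) ⊗₁ (u ∘ φ)))          ≈⟨ refl⟩∘⟨ pullʳ ⊗-merge ⟨
      ψ ∘ (ε ∘ (φ ⊗₁ φ))                        ∎

    λ⇒-conjugate : λ⇒ ∘ ((u ∘ φ) ⊗₁ id) ≈ ψ ∘ ((λ⇒ ∘ (u ⊗₁ id)) ∘ (φ ⊗₁ φ))
    λ⇒-conjugate = begin
      λ⇒ ∘ ((u ∘ φ) ⊗₁ id)                      ≈⟨ cancelˡ ψφ≈id ⟨
      ψ ∘ (φ ∘ (λ⇒ ∘ ((u ∘ φ) ⊗₁ id)))          ≈⟨ refl⟩∘⟨ pullˡ λ-natural ⟩
      ψ ∘ ((λ⇒ ∘ (id ⊗₁ φ)) ∘ ((u ∘ φ) ⊗₁ id))  ≈⟨ refl⟩∘⟨ pullʳ ⊗-merge ⟩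
      ψ ∘ (λ⇒ ∘ ((id ∘ u ∘ φ) ⊗₁ (φ ∘ id)))     ≈⟨ refl⟩∘⟨ refl⟩∘⟨ ⊗-resp-≈ identityˡ (≈-trans identityʳ (≈-sym identityˡ)) ⟩
      ψ ∘ (λ⇒ ∘ ((u ∘ φ) ⊗₁ (id ∘ φ)))          ≈⟨ refl⟩∘⟨ pullʳ ⊗-merge ⟨
      ψ ∘ ((λ⇒ ∘ (u ⊗₁ id)) ∘ (φ ⊗₁ φ))         ∎

  module _ {U} {u : U ⇒ I} (pu : IsCentralIdempotent M u) where
    open IsCentralIdempotent pu

    u∘ε≈u⊗u : u ∘ (ρ⇒ ∘ (id ⊗₁ u)) ≈ λ⇒ ∘ (u ⊗₁ u)
    u∘ε≈u⊗u = begin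
      u ∘ (ρ⇒ ∘ (id ⊗₁ u))          ≈⟨ refl⟩∘⟨ central ⟩
      u ∘ (λ⇒ ∘ (u ⊗₁ id))          ≈⟨ pullˡ λ-natural ⟩
      (λ⇒ ∘ (id ⊗₁ u)) ∘ (u ⊗₁ id)  ≈⟨ pullʳ ⊗-merge ⟩
      λ⇒ ∘ ((id ∘ u) ⊗₁ (u ∘ id))   ≈⟨ refl⟩∘⟨ ⊗-resp-≈ identityˡ identityʳ ⟩
      λ⇒ ∘ (u ⊗₁ u)                 ∎

    ⊗-isCentralIdempotent : IsCentralIdempotent M (λ⇒ ∘ (u ⊗₁ u))
    ⊗-isCentralIdempotent = IsCentralIdempotent-resp-≈ u∘ε≈u⊗u
      (IsCentralIdempotent-∘-iso (ρ⇒ ∘ (id ⊗₁ u)) inv isoˡ isoʳ pu)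

    u≈u⊗u∘inv : u ≈ (λ⇒ ∘ (u ⊗₁ u)) ∘ inv
    u≈u⊗u∘inv = begin
      u                             ≈⟨ elimʳ isoʳ ⟨
      u ∘ ((ρ⇒ ∘ (id ⊗₁ u)) ∘ inv)  ≈⟨ sym-assoc ⟩
      (u ∘ (ρ⇒ ∘ (id ⊗₁ u))) ∘ inv  ≈⟨ u∘ε≈u⊗u ⟩∘⟨refl ⟩
      (λ⇒ ∘ (u ⊗₁ u)) ∘ inv         ∎

module Restriction {o ℓ e} {C : Category o ℓ e} (M : SymmetricMonoidal C)
                   {U : Category.Obj C} (u : Category._⇒_ C U (SymmetricMonoidal.I M))
                   (pu : IsCentralIdempotent M u) where
  open Category C
  open SymmetricMonoidal M
  open MonoidalReasoning M
  open IsCentralIdempotent pu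

  ε : ∀ {A} → A ⊗₀ U ⇒ A
  ε = ρ⇒ ∘ (id ⊗₁ u)

  δ : ∀ {A} → A ⊗₀ U ⇒ (A ⊗₀ U) ⊗₀ U
  δ = α⇐ ∘ (id ⊗₁ inv)

  infixr 9 _∘ᵤ_

  _∘ᵤ_ : ∀ {A B D} → B ⊗₀ U ⇒ D → A ⊗₀ U ⇒ B → A ⊗₀ U ⇒ D
  g ∘ᵤ f = g ∘ (f ⊗₁ id) ∘ δ

  -- The functor C → C|_u; in particular the identity of C|_u is lift id = ε.
  lift : ∀ {A B} → A ⇒ B → A ⊗₀ U ⇒ B
  lift h = ρ⇒ ∘ (h ⊗₁ u)

  lift-resp-≈ : ∀ {A B} {h k : A ⇒ B} → h ≈ k → lift h ≈ lift k
  lift-resp-≈ h≈k = refl⟩∘⟨ ⊗-resp-≈ h≈k ≈-refl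

  lift≈∘ε : ∀ {A B} {h : A ⇒ B} → lift h ≈ h ∘ ε
  lift≈∘ε = ≈-trans (refl⟩∘⟨ ⊗-split) (≈-trans (pullˡ (≈-sym ρ-natural)) assoc)

  ε-natural : ∀ {A B} {h : A ⇒ B} → ε ∘ (h ⊗₁ id) ≈ h ∘ ε
  ε-natural {h = h} = begin
    (ρ⇒ ∘ (id ⊗₁ u)) ∘ (h ⊗₁ id)  ≈⟨ pullʳ ⊗-merge ⟩
    ρ⇒ ∘ ((id ∘ h) ⊗₁ (u ∘ id))   ≈⟨ refl⟩∘⟨ ⊗-resp-≈ identityˡ identityʳ ⟩
    lift h                        ≈⟨ lift≈∘ε ⟩
    h ∘ ε                         ∎

  ε∘δ≈id : ∀ {A} → ε ∘ δ ≈ id {A ⊗₀ U}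
  ε∘δ≈id = begin
    ε ∘ α⇐ ∘ (id ⊗₁ inv)                        ≈⟨ assoc ⟩
    ρ⇒ ∘ (id ⊗₁ u) ∘ α⇐ ∘ (id ⊗₁ inv)           ≈⟨ refl⟩∘⟨ (⊗-resp-≈ ⊗-identity ≈-refl ⟩∘⟨refl) ⟨
    ρ⇒ ∘ ((id ⊗₁ id) ⊗₁ u) ∘ α⇐ ∘ (id ⊗₁ inv)   ≈⟨ refl⟩∘⟨ pullˡ α⇐-natural ⟩
    ρ⇒ ∘ (α⇐ ∘ (id ⊗₁ id ⊗₁ u)) ∘ (id ⊗₁ inv)   ≈⟨ refl⟩∘⟨ assoc ⟩
    ρ⇒ ∘ α⇐ ∘ (id ⊗₁ id ⊗₁ u) ∘ (id ⊗₁ inv)     ≈⟨ pullˡ ρ⇒∘α⇐ ⟩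
    (id ⊗₁ ρ⇒) ∘ (id ⊗₁ id ⊗₁ u) ∘ (id ⊗₁ inv)  ≈⟨ pullˡ id⊗-merge ⟩
    (id ⊗₁ ε) ∘ (id ⊗₁ inv)                     ≈⟨ id⊗-merge ⟩
    id ⊗₁ (ε ∘ inv)                             ≈⟨ ⊗-resp-id ≈-refl isoʳ ⟩
    id                                          ∎

  ε⊗id∘δ≈id : ∀ {A} → (ε ⊗₁ id) ∘ δ ≈ id {A ⊗₀ U}
  ε⊗id∘δ≈id = begin
    (ε ⊗₁ id) ∘ α⇐ ∘ (id ⊗₁ inv)                         ≈⟨ ⊗id-merge ⟩∘⟨refl ⟨
    ((ρ⇒ ⊗₁ id) ∘ ((id ⊗₁ u) ⊗₁ id)) ∘ α⇐ ∘ (id ⊗₁ inv)  ≈⟨ assoc ⟩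
    (ρ⇒ ⊗₁ id) ∘ ((id ⊗₁ u) ⊗₁ id) ∘ α⇐ ∘ (id ⊗₁ inv)    ≈⟨ refl⟩∘⟨ pullˡ α⇐-natural ⟩
    (ρ⇒ ⊗₁ id) ∘ (α⇐ ∘ (id ⊗₁ u ⊗₁ id)) ∘ (id ⊗₁ inv)    ≈⟨ refl⟩∘⟨ assoc ⟩
    (ρ⇒ ⊗₁ id) ∘ α⇐ ∘ (id ⊗₁ u ⊗₁ id) ∘ (id ⊗₁ inv)      ≈⟨ pullˡ ρ⇒⊗id∘α⇐ ⟩
    (id ⊗₁ λ⇒) ∘ (id ⊗₁ u ⊗₁ id) ∘ (id ⊗₁ inv)           ≈⟨ pullˡ id⊗-merge ⟩
    (id ⊗₁ (λ⇒ ∘ (u ⊗₁ id))) ∘ (id ⊗₁ inv)               ≈⟨ id⊗-merge ⟩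
    id ⊗₁ ((λ⇒ ∘ (u ⊗₁ id)) ∘ inv)                       ≈⟨ ⊗-resp-≈ ≈-refl (central ⟩∘⟨refl) ⟨
    id ⊗₁ (ε ∘ inv)                                      ≈⟨ ⊗-resp-id ≈-refl isoʳ ⟩
    id                                                   ∎

  lift-∘ᵤ : ∀ {A B D} {h : B ⇒ D} {k : A ⊗₀ U ⇒ B} → lift h ∘ᵤ k ≈ h ∘ k
  lift-∘ᵤ {h = h} {k} = begin
    lift h ∘ (k ⊗₁ id) ∘ δ   ≈⟨ lift≈∘ε ⟩∘⟨refl ⟩
    (h ∘ ε) ∘ (k ⊗₁ id) ∘ δ  ≈⟨ assoc ⟩
    h ∘ ε ∘ (k ⊗₁ id) ∘ δ    ≈⟨ refl⟩∘⟨ pullˡ ε-natural ⟩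
    h ∘ (k ∘ ε) ∘ δ          ≈⟨ refl⟩∘⟨ pullʳ ε∘δ≈id ⟩
    h ∘ k ∘ id               ≈⟨ refl⟩∘⟨ identityʳ ⟩
    h ∘ k                    ∎

  ∘ᵤ-lift : ∀ {A B D} {h : A ⇒ B} {k : B ⊗₀ U ⇒ D} → k ∘ᵤ lift h ≈ k ∘ (h ⊗₁ id)
  ∘ᵤ-lift {h = h} {k} = begin
    k ∘ (lift h ⊗₁ id) ∘ δ           ≈⟨ refl⟩∘⟨ (⊗-resp-≈ lift≈∘ε ≈-refl ⟩∘⟨refl) ⟩
    k ∘ ((h ∘ ε) ⊗₁ id) ∘ δ          ≈⟨ refl⟩∘⟨ (⊗id-merge ⟩∘⟨refl) ⟨
    k ∘ ((h ⊗₁ id) ∘ (ε ⊗₁ id)) ∘ δ  ≈⟨ refl⟩∘⟨ pullʳ ε⊗id∘δ≈id ⟩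
    k ∘ (h ⊗₁ id) ∘ id               ≈⟨ refl⟩∘⟨ identityʳ ⟩
    k ∘ (h ⊗₁ id)                    ∎

  lift-homomorphism : ∀ {A B D} {h : B ⇒ D} {k : A ⇒ B} → lift (h ∘ k) ≈ lift h ∘ᵤ lift k
  lift-homomorphism {h = h} {k} = begin
    lift (h ∘ k)      ≈⟨ lift≈∘ε ⟩
    (h ∘ k) ∘ ε       ≈⟨ assoc ⟩
    h ∘ k ∘ ε         ≈⟨ refl⟩∘⟨ lift≈∘ε ⟨
    h ∘ lift k        ≈⟨ lift-∘ᵤ ⟨
    lift h ∘ᵤ lift k  ∎

module RestrictedMonad {o ℓ e} {C : Category o ℓ e} (M : SymmetricMonoidal C)
                       (T : Monad (Category.raw C)) (L : Localisable M T)
                       {U : Category.Obj C} (u : Category._⇒_ C U (SymmetricMonoidal.I M))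
                       (pu : IsCentralIdempotent M u) where
  open Category C
  open SymmetricMonoidal M
  open MonoidalReasoning M
  open CentralIdempotents M
  open Restriction M u pu
  open IsCentralIdempotent pu using (inv)
  open Monad T using (η; μ; F-resp-≈; F-identity; F-homomorphism; η-natural; μ-natural)
    renaming (F₀ to T₀; F₁ to T₁; assoc to μ-assoc; identityˡ to μ-identityˡ; identityʳ to μ-identityʳ)
  open Localisable L

  stᵤ : ∀ A → T₀ A ⊗₀ U ⇒ T₀ (A ⊗₀ U)
  stᵤ A = st A u pu

  Tᵤ : ∀ {A B} → A ⊗₀ U ⇒ B → T₀ A ⊗₀ U ⇒ T₀ B
  Tᵤ {A} f = T₁ f ∘ stᵤ A

  T₁-∘-split : ∀ {X A B D} {h : B ⇒ D} {k : A ⇒ B} {s : X ⇒ T₀ A} →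
               T₁ (h ∘ k) ∘ s ≈ T₁ h ∘ T₁ k ∘ s
  T₁-∘-split = ≈-trans (F-homomorphism ⟩∘⟨refl) assoc

  -- u ≤ id with witness u, and st along id is the right unitor.
  T₁ε∘stᵤ : ∀ {A} → T₁ ε ∘ stᵤ A ≈ ε
  T₁ε∘stᵤ {A} = begin
    T₁ (ρ⇒ ∘ (id ⊗₁ u)) ∘ stᵤ A                         ≈⟨ T₁-∘-split ⟩
    T₁ ρ⇒ ∘ T₁ (id ⊗₁ u) ∘ stᵤ A                        ≈⟨ refl⟩∘⟨ st-≤ pu id-isCentralIdempotent u (≈-sym identityˡ) ⟨
    T₁ ρ⇒ ∘ st A id id-isCentralIdempotent ∘ (id ⊗₁ u)  ≈⟨ pullˡ (st-unitor id-isCentralIdempotent) ⟩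
    ρ⇒ ∘ (id ⊗₁ u)                                      ∎

  Tᵤ-lift : ∀ {A B} {h : A ⇒ B} → Tᵤ (lift h) ≈ lift (T₁ h)
  Tᵤ-lift {A} {h = h} = begin
    T₁ (lift h) ∘ stᵤ A  ≈⟨ F-resp-≈ lift≈∘ε ⟩∘⟨refl ⟩
    T₁ (h ∘ ε) ∘ stᵤ A   ≈⟨ T₁-∘-split ⟩
    T₁ h ∘ T₁ ε ∘ stᵤ A  ≈⟨ refl⟩∘⟨ T₁ε∘stᵤ ⟩
    T₁ h ∘ ε             ≈⟨ lift≈∘ε ⟨
    lift (T₁ h)          ∎

  -- Strength along u ⊗ u, restricted along u ≤ u ⊗ u (witnessed by inv).
  stᵤ-δ : ∀ {A} → stᵤ (A ⊗₀ U) ∘ (stᵤ A ⊗₁ id) ∘ δ ≈ T₁ δ ∘ stᵤ A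
  stᵤ-δ {A} = begin
    stᵤ (A ⊗₀ U) ∘ (stᵤ A ⊗₁ id) ∘ α⇐ ∘ (id ⊗₁ inv)    ≈⟨ refl⟩∘⟨ sym-assoc ⟩
    stᵤ (A ⊗₀ U) ∘ ((stᵤ A ⊗₁ id) ∘ α⇐) ∘ (id ⊗₁ inv)  ≈⟨ sym-assoc ⟩
    (stᵤ (A ⊗₀ U) ∘ (stᵤ A ⊗₁ id) ∘ α⇐) ∘ (id ⊗₁ inv)  ≈⟨ st-assoc pu pu pu⊗u ⟩∘⟨refl ⟨
    (T₁ α⇐ ∘ st A (λ⇒ ∘ (u ⊗₁ u)) pu⊗u) ∘ (id ⊗₁ inv)  ≈⟨ assoc ⟩
    T₁ α⇐ ∘ st A (λ⇒ ∘ (u ⊗₁ u)) pu⊗u ∘ (id ⊗₁ inv)    ≈⟨ refl⟩∘⟨ st-≤ pu pu⊗u inv (u≈u⊗u∘inv pu) ⟩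
    T₁ α⇐ ∘ T₁ (id ⊗₁ inv) ∘ stᵤ A                     ≈⟨ T₁-∘-split ⟨
    T₁ δ ∘ stᵤ A                                       ∎
    where
    pu⊗u : IsCentralIdempotent M (λ⇒ ∘ (u ⊗₁ u))
    pu⊗u = ⊗-isCentralIdempotent pu

  Tᵤ-resp-≈ : ∀ {A B} {f g : A ⊗₀ U ⇒ B} → f ≈ g → Tᵤ f ≈ Tᵤ g
  Tᵤ-resp-≈ f≈g = F-resp-≈ f≈g ⟩∘⟨refl

  Tᵤ-identity : ∀ {A} → Tᵤ (lift (id {A})) ≈ lift id
  Tᵤ-identity = ≈-trans Tᵤ-lift (lift-resp-≈ F-identity)

  Tᵤ-homomorphism : ∀ {A B D} {f : A ⊗₀ U ⇒ B} {g : B ⊗₀ U ⇒ D} →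
                    Tᵤ (g ∘ᵤ f) ≈ Tᵤ g ∘ᵤ Tᵤ f
  Tᵤ-homomorphism {A} {B} {f = f} {g} = begin
    T₁ (g ∘ (f ⊗₁ id) ∘ δ) ∘ stᵤ A                            ≈⟨ T₁-∘-split ⟩
    T₁ g ∘ T₁ ((f ⊗₁ id) ∘ δ) ∘ stᵤ A                         ≈⟨ refl⟩∘⟨ T₁-∘-split ⟩
    T₁ g ∘ T₁ (f ⊗₁ id) ∘ T₁ δ ∘ stᵤ A                        ≈⟨ refl⟩∘⟨ refl⟩∘⟨ stᵤ-δ ⟨
    T₁ g ∘ T₁ (f ⊗₁ id) ∘ stᵤ (A ⊗₀ U) ∘ (stᵤ A ⊗₁ id) ∘ δ    ≈⟨ refl⟩∘⟨ sym-assoc ⟩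
    T₁ g ∘ (T₁ (f ⊗₁ id) ∘ stᵤ (A ⊗₀ U)) ∘ (stᵤ A ⊗₁ id) ∘ δ  ≈⟨ refl⟩∘⟨ pullˡ (st-natural pu f) ⟨
    T₁ g ∘ stᵤ B ∘ (T₁ f ⊗₁ id) ∘ (stᵤ A ⊗₁ id) ∘ δ           ≈⟨ refl⟩∘⟨ refl⟩∘⟨ pullˡ ⊗id-merge ⟩
    T₁ g ∘ stᵤ B ∘ (Tᵤ f ⊗₁ id) ∘ δ                           ≈⟨ sym-assoc ⟩
    Tᵤ g ∘ᵤ Tᵤ f                                              ∎

  ηᵤ-natural : ∀ {A B} (f : A ⊗₀ U ⇒ B) → lift (η B) ∘ᵤ f ≈ Tᵤ f ∘ᵤ lift (η A)
  ηᵤ-natural {A} {B} f = begin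
    lift (η B) ∘ᵤ f             ≈⟨ lift-∘ᵤ ⟩
    η B ∘ f                     ≈⟨ η-natural f ⟩
    T₁ f ∘ η (A ⊗₀ U)           ≈⟨ refl⟩∘⟨ st-η pu ⟩
    T₁ f ∘ stᵤ A ∘ (η A ⊗₁ id)  ≈⟨ sym-assoc ⟩
    Tᵤ f ∘ (η A ⊗₁ id)          ≈⟨ ∘ᵤ-lift ⟨
    Tᵤ f ∘ᵤ lift (η A)          ∎

  μᵤ-natural : ∀ {A B} (f : A ⊗₀ U ⇒ B) → lift (μ B) ∘ᵤ Tᵤ (Tᵤ f) ≈ Tᵤ f ∘ᵤ lift (μ A)
  μᵤ-natural {A} {B} f = begin
    lift (μ B) ∘ᵤ Tᵤ (Tᵤ f)                        ≈⟨ lift-∘ᵤ ⟩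
    μ B ∘ T₁ (T₁ f ∘ stᵤ A) ∘ stᵤ (T₀ A)           ≈⟨ refl⟩∘⟨ T₁-∘-split ⟩
    μ B ∘ T₁ (T₁ f) ∘ T₁ (stᵤ A) ∘ stᵤ (T₀ A)      ≈⟨ pullˡ (μ-natural f) ⟩
    (T₁ f ∘ μ (A ⊗₀ U)) ∘ T₁ (stᵤ A) ∘ stᵤ (T₀ A)  ≈⟨ assoc ⟩
    T₁ f ∘ μ (A ⊗₀ U) ∘ T₁ (stᵤ A) ∘ stᵤ (T₀ A)    ≈⟨ refl⟩∘⟨ st-μ pu ⟩
    T₁ f ∘ stᵤ A ∘ (μ A ⊗₁ id)                     ≈⟨ sym-assoc ⟩
    Tᵤ f ∘ (μ A ⊗₁ id)                             ≈⟨ ∘ᵤ-lift ⟨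
    Tᵤ f ∘ᵤ lift (μ A)                             ∎

  μᵤ-assoc : ∀ {A} → lift (μ A) ∘ᵤ Tᵤ (lift (μ A)) ≈ lift (μ A) ∘ᵤ lift (μ (T₀ A))
  μᵤ-assoc {A} = begin
    lift (μ A) ∘ᵤ Tᵤ (lift (μ A))  ≈⟨ refl⟩∘⟨ (⊗-resp-≈ Tᵤ-lift ≈-refl ⟩∘⟨refl) ⟩
    lift (μ A) ∘ᵤ lift (T₁ (μ A))  ≈⟨ lift-homomorphism ⟨
    lift (μ A ∘ T₁ (μ A))          ≈⟨ lift-resp-≈ μ-assoc ⟩
    lift (μ A ∘ μ (T₀ A))          ≈⟨ lift-homomorphism ⟩
    lift (μ A) ∘ᵤ lift (μ (T₀ A))  ∎

  μᵤ-identityˡ : ∀ {A} → lift (μ A) ∘ᵤ Tᵤ (lift (η A)) ≈ lift id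
  μᵤ-identityˡ {A} = begin
    lift (μ A) ∘ᵤ Tᵤ (lift (η A))  ≈⟨ refl⟩∘⟨ (⊗-resp-≈ Tᵤ-lift ≈-refl ⟩∘⟨refl) ⟩
    lift (μ A) ∘ᵤ lift (T₁ (η A))  ≈⟨ lift-homomorphism ⟨
    lift (μ A ∘ T₁ (η A))          ≈⟨ lift-resp-≈ μ-identityˡ ⟩
    lift id                        ∎

  μᵤ-identityʳ : ∀ {A} → lift (μ A) ∘ᵤ lift (η (T₀ A)) ≈ lift id
  μᵤ-identityʳ {A} = begin
    lift (μ A) ∘ᵤ lift (η (T₀ A))  ≈⟨ lift-homomorphism ⟨
    lift (μ A ∘ η (T₀ A))          ≈⟨ lift-resp-≈ μ-identityʳ ⟩
    lift id                        ∎

proposition3p5 : ∀ {o ℓ e} {C : Category o ℓ e} (M : SymmetricMonoidal C)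
                   (T : Monad (Category.raw C)) (L : Localisable M T)
                   {U : Category.Obj C}
                   (u : Category._⇒_ C U (SymmetricMonoidal.I M))
                   (pu : IsCentralIdempotent M u) →
                   IsMonad (restrict M u pu) (restrictMonad M T L u pu)
proposition3p5 M T L u pu = record
  { F-resp-≈       = Tᵤ-resp-≈
  ; F-identity     = Tᵤ-identity
  ; F-homomorphism = Tᵤ-homomorphism
  ; η-natural      = ηᵤ-natural
  ; μ-natural      = μᵤ-natural
  ; assoc          = μᵤ-assoc
  ; identityˡ      = μᵤ-identityˡ
  ; identityʳ      = μᵤ-identityʳ
  }
  where open RestrictedMonad M T L u pu
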